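{- For every even integer $m\geq 4$ there exists an $SMR(m,5m/2;5,2)$.
   Context: A signed magic rectangle $SMR(m,n;r,s)$ is an $m\times n$ array, some of whose cells are filled with integers and the others empty, such that exactly $r$ cells in every row and exactly $s$ cells in every column are filled (so $mr=ns$), every element of $X$ appears exactly once in the array, and the sum of the entries of each row and of each column is zero, where (for $mr$ even) $X=\{\pm1,\pm2,\ldots,\pm mr/2\}$. -}

module Defs where

open import Data.Nat using (ℕ; zero; suc; _*_; _≤_)
open import Data.Integer as ℤ using (ℤ; ∣_∣; +_)
open import Data.Fin using (Fin)
open import Data.List using (List; []; _∷_; map; concatMap)
open import Data.List using (allFin)
open import Data.Maybe using (Maybe; just; nothing; is-just)
open import Data.Bool using (T)
open import Data.Product using (_×_; _,_)
open import Relation.Binary.PropositionalEquality using (_≡_)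
open import Relation.Nullary using (¬_; yes; no)

-- A partially filled m × n array with integer entries (nothing = empty cell).
PArray : ℕ → ℕ → Set
PArray m n = Fin m → Fin n → Maybe ℤ

val : Maybe ℤ → ℤ
val (just x) = x
val nothing  = + 0

filledCount : List (Maybe ℤ) → ℕ
filledCount [] = 0
filledCount (nothing ∷ cs) = filledCount cs
filledCount (just _ ∷ cs) = suc (filledCount cs)

cellSum : List (Maybe ℤ) → ℤ
cellSum [] = + 0
cellSum (c ∷ cs) = val c ℤ.+ cellSum cs

row : ∀ {m n} → PArray m n → Fin m → List (Maybe ℤ)
row {n = n} A i = map (A i) (allFin n)

col : ∀ {m n} → PArray m n → Fin n → List (Maybe ℤ)
col {m = m} A j = map (λ i → A i j) (allFin m)

cells : ∀ {m n} → PArray m n → List (Maybe ℤ)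
cells {m = m} A = concatMap (row A) (allFin m)

occurrences : ℤ → List (Maybe ℤ) → ℕ
occurrences x [] = 0
occurrences x (nothing ∷ cs) = occurrences x cs
occurrences x (just y ∷ cs) with x ℤ.≟ y
... | yes _ = suc (occurrences x cs)
... | no  _ = occurrences x cs

InX : ℕ → ℤ → Set
InX k x = ¬ (x ≡ + 0) × ∣ x ∣ ≤ k

-- Signed magic rectangle SMR(m,n;r,s), for m*r even, with X = {±1,…,±(m*r/2)}.
-- The parameter k stands for m*r/2 and is tied to it by  2 * k ≡ m * r.
record IsSMR (m n r s k : ℕ) (A : PArray m n) : Set where
  field
    half       : 2 * k ≡ m * r
    rowFilled  : ∀ i → filledCount (row A i) ≡ r
    colFilled  : ∀ j → filledCount (col A j) ≡ s
    entriesInX : ∀ i j x → A i j ≡ just x → InX k x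
    eachOnce   : ∀ x → InX k x → occurrences x (cells A) ≡ 1
    rowSum     : ∀ i → cellSum (row A i) ≡ + 0
    colSum     : ∀ j → cellSum (col A j) ≡ + 0

module Submission where

-- Write m = 2t with t ≥ 2 and pair the rows as 2k, 2k+1 (k ∈ ℤ/t, k' = k + 1). Give column j the
-- two entries +(j+1) and −(j+1) in two distinct rows: then every column sums to zero and every element
-- of X = {±1, …, ±5t} occurs exactly once, whatever the placement. The columns k, t+k, 2t+k put their
-- entries (+,−) into the rows (2k, 2k'), (2k, 2k+1), (2k', 2k+1), and the columns 3t+2k, 3t+2k+1 into
-- (2k+1, 2k'+1), (2k'+1, 2k). Within each of these blocks a row is hit at most once by a + and once by
-- a −, so with p = q − 1 (mod t) row 2q holds +(q+1), −(p+1), +(t+q+1), +(2t+p+1), −(3t+2q+2) and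
-- row 2q+1 holds −(t+q+1), −(2t+q+1), +(3t+2q+1), −(3t+2p+1), +(3t+2p+2); both sum to zero.

open import Defs
open import Data.Nat using (ℕ; _*_; _≤_; _/_)
open import Data.Nat.Divisibility using (_∣_)
open import Data.Product using (∃)

open import Data.Bool using (Bool; true; false; if_then_else_; T)
open import Data.Empty using (⊥-elim)
open import Data.Fin using (toℕ)
open import Data.Fin.Properties using (toℕ<n)
open import Data.Integer as ℤ using (ℤ; +_; -_; -[1+_]; 0ℤ; 1ℤ) renaming (_+_ to _⊕_)
import Data.Integer.Properties as ℤₚ
open import Algebra.Properties.CommutativeSemigroup ℤₚ.+-commutativeSemigroup using (interchange)
import Data.Integer.Tactic.RingSolver as ℤ-Solver
open import Data.List using (List; []; _∷_; _++_; map; concat; tabulate; allFin)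
open import Data.List.Properties using (map-tabulate)
open import Data.Maybe using (Maybe; just; nothing)
open import Data.Maybe.Properties using (just-injective)
open import Data.Nat using (zero; suc; pred; _+_; _<_; z≤n; s≤s; z<s; s<s; _≡ᵇ_)
open import Data.Nat.Divisibility using (divides)
open import Data.Nat.DivMod using (m*n/n≡m)
import Data.Nat.Properties as ℕₚ
import Data.Nat.Tactic.RingSolver as ℕ-Solver
open import Data.Product using (_×_; _,_; proj₁; proj₂)
open import Data.Sum using (_⊎_; inj₁; inj₂)
open import Function using (_∘_)
open import Relation.Binary.PropositionalEquality
open import Relation.Nullary using (¬_; does; yes; no)
open import Relation.Nullary.Decidable using (dec-true; dec-false)

∑ : ℕ → (ℕ → ℤ) → ℤ
∑ zero    f = 0ℤ
∑ (suc n) f = f 0 ⊕ ∑ n (f ∘ suc)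

syntax ∑ n (λ k → e) = ∑[ k < n ] e

∑-cong : ∀ n {f g : ℕ → ℤ} → (∀ k → k < n → f k ≡ g k) → ∑ n f ≡ ∑ n g
∑-cong zero    _   = refl
∑-cong (suc n) f≗g = cong₂ _⊕_ (f≗g 0 z<s) (∑-cong n (λ k k<n → f≗g (suc k) (s<s k<n)))

∑-zero : ∀ n (f : ℕ → ℤ) → (∀ k → k < n → f k ≡ 0ℤ) → ∑ n f ≡ 0ℤ
∑-zero zero    f _   = refl
∑-zero (suc n) f f≡0 = cong₂ _⊕_ (f≡0 0 z<s) (∑-zero n (f ∘ suc) (λ k k<n → f≡0 (suc k) (s<s k<n)))

∑-single : ∀ n (f : ℕ → ℤ) {k₀} → k₀ < n →
           (∀ k → k < n → k ≢ k₀ → f k ≡ 0ℤ) → ∑ n f ≡ f k₀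
∑-single (suc n) f {zero} _ off =
  trans (cong (f 0 ⊕_) (∑-zero n (f ∘ suc) (λ k k<n → off (suc k) (s<s k<n) λ ())))
        (ℤₚ.+-identityʳ (f 0))
∑-single (suc n) f {suc k₀} (s<s k₀<n) off =
  trans (cong (_⊕ ∑ n (f ∘ suc)) (off 0 z<s λ ()))
        (trans (ℤₚ.+-identityˡ _)
               (∑-single n (f ∘ suc) k₀<n
                         (λ k k<n k≢k₀ → off (suc k) (s<s k<n) (k≢k₀ ∘ ℕₚ.suc-injective))))

∑-distrib-⊕ : ∀ n (f g : ℕ → ℤ) → ∑[ k < n ] (f k ⊕ g k) ≡ ∑ n f ⊕ ∑ n g
∑-distrib-⊕ zero    f g = refl
∑-distrib-⊕ (suc n) f g =
  trans (cong (f 0 ⊕ g 0 ⊕_) (∑-distrib-⊕ n (f ∘ suc) (g ∘ suc))) (interchange (f 0) (g 0) _ _)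

∑-⊕ : ∀ n {f g : ℕ → ℤ} {x y} → ∑ n f ≡ x → ∑ n g ≡ y → ∑[ k < n ] (f k ⊕ g k) ≡ x ⊕ y
∑-⊕ n {f} {g} refl refl = ∑-distrib-⊕ n f g

∑-comm : ∀ m n (f : ℕ → ℕ → ℤ) → ∑[ i < m ] (∑[ j < n ] f i j) ≡ ∑[ j < n ] (∑[ i < m ] f i j)
∑-comm zero    n f = sym (∑-zero n _ (λ _ _ → refl))
∑-comm (suc m) n f =
  trans (cong ((∑[ j < n ] f 0 j) ⊕_) (∑-comm m n (f ∘ suc))) (sym (∑-distrib-⊕ n (f 0) _))

∑-if-unique : ∀ n (b : ℕ → Bool) (w : ℕ → ℤ) {k₀} → k₀ < n → T (b k₀) →
              (∀ k → k < n → T (b k) → k ≡ k₀) →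
              ∑[ k < n ] (if b k then w k else 0ℤ) ≡ w k₀
∑-if-unique n b w {k₀} k₀<n bk₀ unique = trans (∑-single n _ k₀<n off) (taken (b k₀) bk₀)
  where
  taken : ∀ c → T c → (if c then w k₀ else 0ℤ) ≡ w k₀
  taken true _ = refl
  off : ∀ k → k < n → k ≢ k₀ → (if b k then w k else 0ℤ) ≡ 0ℤ
  off k k<n k≢k₀ with b k in bk
  ... | false = refl
  ... | true  = ⊥-elim (k≢k₀ (unique k k<n (subst T (sym bk) _)))

∑-if-none : ∀ n (b : ℕ → Bool) (w : ℕ → ℤ) → (∀ k → k < n → ¬ T (b k)) →
            ∑[ k < n ] (if b k then w k else 0ℤ) ≡ 0ℤ
∑-if-none n b w never = ∑-zero n _ off
  where
  off : ∀ k → k < n → (if b k then w k else 0ℤ) ≡ 0ℤ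
  off k k<n with b k in bk
  ... | false = refl
  ... | true  = ⊥-elim (never k k<n (subst T (sym bk) _))

∑-match-unique : ∀ n r (α : ℕ → ℕ) (w : ℕ → ℤ) {k₀} → k₀ < n → r ≡ α k₀ →
                 (∀ k → k < n → r ≡ α k → k ≡ k₀) →
                 ∑[ k < n ] (if r ≡ᵇ α k then w k else 0ℤ) ≡ w k₀
∑-match-unique n r α w k₀<n r≡αk₀ unique =
  ∑-if-unique n (λ k → r ≡ᵇ α k) w k₀<n (ℕₚ.≡⇒≡ᵇ _ _ r≡αk₀)
              (λ k k<n → unique k k<n ∘ ℕₚ.≡ᵇ⇒≡ _ _)

∑-match-none : ∀ n r (α : ℕ → ℕ) (w : ℕ → ℤ) → (∀ k → k < n → r ≢ α k) →
               ∑[ k < n ] (if r ≡ᵇ α k then w k else 0ℤ) ≡ 0ℤ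
∑-match-none n r α w never =
  ∑-if-none n (λ k → r ≡ᵇ α k) w (λ k k<n → never k k<n ∘ ℕₚ.≡ᵇ⇒≡ _ _)

splice : {A : Set} → ℕ → (ℕ → A) → (ℕ → A) → ℕ → A
splice zero    f g j       = g j
splice (suc a) f g zero    = f zero
splice (suc a) f g (suc j) = splice a (f ∘ suc) g j

interleave : {A : Set} → (ℕ → A) → (ℕ → A) → ℕ → A
interleave f g zero          = f zero
interleave f g (suc zero)    = g zero
interleave f g (suc (suc j)) = interleave (f ∘ suc) (g ∘ suc) j

splice-all : ∀ {A : Set} (P : A → Set) a b {f g : ℕ → A} →
             (∀ j → j < a → P (f j)) → (∀ k → k < b → P (g k)) →
             ∀ j → j < a + b → P (splice a f g j)
splice-all P zero    b pf pg j       j<b       = pg j j<b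
splice-all P (suc a) b pf pg zero    _         = pf 0 z<s
splice-all P (suc a) b pf pg (suc j) (s<s j<)  = splice-all P a b (λ i i<a → pf (suc i) (s<s i<a)) pg j j<

interleave-all : ∀ {A : Set} (P : A → Set) n {f g : ℕ → A} →
                 (∀ k → k < n → P (f k)) → (∀ k → k < n → P (g k)) →
                 ∀ j → j < n * 2 → P (interleave f g j)
interleave-all P (suc n) pf pg zero          _              = pf 0 z<s
interleave-all P (suc n) pf pg (suc zero)    _              = pg 0 z<s
interleave-all P (suc n) pf pg (suc (suc j)) (s<s (s<s j<)) =
  interleave-all P n (λ k k<n → pf (suc k) (s<s k<n)) (λ k k<n → pg (suc k) (s<s k<n)) j j<

∑-splice : ∀ a b {A : Set} (f g : ℕ → A) (h : A → ℕ → ℤ) →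
           ∑[ j < a + b ] h (splice a f g j) j ≡ ∑[ j < a ] h (f j) j ⊕ ∑[ k < b ] h (g k) (a + k)
∑-splice zero    b f g h = sym (ℤₚ.+-identityˡ _)
∑-splice (suc a) b f g h =
  trans (cong (h (f 0) 0 ⊕_) (∑-splice a b (f ∘ suc) g (λ x j → h x (suc j))))
        (sym (ℤₚ.+-assoc (h (f 0) 0) _ _))

∑-interleave : ∀ n {A : Set} (f g : ℕ → A) (h : A → ℕ → ℤ) →
               ∑[ j < n * 2 ] h (interleave f g j) j ≡ ∑[ k < n ] (h (f k) (k * 2) ⊕ h (g k) (suc (k * 2)))
∑-interleave zero    f g h = refl
∑-interleave (suc n) f g h =
  trans (sym (ℤₚ.+-assoc (h (f 0) 0) (h (g 0) 1) _))
        (cong (h (f 0) 0 ⊕ h (g 0) 1 ⊕_) (∑-interleave n (f ∘ suc) (g ∘ suc) (λ x j → h x (suc (suc j)))))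

-- Doubling is written k * 2 rather than 2 * k since suc k * 2 reduces to suc (suc (k * 2)).
m*2≢1+n*2 : ∀ m n → m * 2 ≢ suc (n * 2)
m*2≢1+n*2 (suc m) (suc n) eq = m*2≢1+n*2 m n (ℕₚ.suc-injective (ℕₚ.suc-injective eq))

m*2≡m+m : ∀ m → m * 2 ≡ m + m
m*2≡m+m = ℕ-Solver.solve-∀

*2-injective : ∀ {m n} → m * 2 ≡ n * 2 → m ≡ n
*2-injective = ℕₚ.*-cancelʳ-≡ _ _ 2

*2-<⁻¹ : ∀ {m n} → m * 2 < n * 2 → m < n
*2-<⁻¹ = ℕₚ.*-cancelʳ-< 2 _ _

1+*2-<⁻¹ : ∀ {m n} → suc (m * 2) < n * 2 → m < n
1+*2-<⁻¹ {m} = ℕₚ.*-cancelʳ-≤ (suc m) _ 2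

*2-< : ∀ {m n} → m < n → m * 2 < n * 2
*2-< = ℕₚ.*-monoˡ-< 2

1+*2-< : ∀ {m n} → m < n → suc (m * 2) < n * 2
1+*2-< = ℕₚ.*-monoˡ-≤ 2

data EvenOdd : ℕ → Set where
  even : ∀ k → EvenOdd (k * 2)
  odd  : ∀ k → EvenOdd (suc (k * 2))

evenOdd : ∀ n → EvenOdd n
evenOdd zero    = even 0
evenOdd (suc n) with evenOdd n
... | even k = odd k
... | odd k  = even (suc k)

module Cyclic (t : ℕ) (2≤t : 2 ≤ t) where

  next : ℕ → ℕ
  next k = if suc k ≡ᵇ t then 0 else suc k

  prev : ℕ → ℕ
  prev zero    = pred t
  prev (suc q) = q

  private
    1+pred : ∀ {n} → 2 ≤ n → suc (pred n) ≡ n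
    1+pred (s≤s _) = refl

    1≢t : 1 ≢ t
    1≢t 1≡t = ℕₚ.<-irrefl refl (subst (2 ≤_) (sym 1≡t) 2≤t)

  next-< : ∀ {k} → k < t → next k < t
  next-< {k} k<t with suc k ≡ᵇ t in eq
  ... | true  = ℕₚ.≤-<-trans z≤n k<t
  ... | false = ℕₚ.≤∧≢⇒< k<t (λ 1+k≡t → subst T eq (ℕₚ.≡⇒≡ᵇ _ _ 1+k≡t))

  next-≢ : ∀ {k} → next k ≢ k
  next-≢ {k} with suc k ≡ᵇ t in eq
  ... | true  = λ { refl → 1≢t (ℕₚ.≡ᵇ⇒≡ 1 t (subst T (sym eq) _)) }
  ... | false = ℕₚ.1+n≢n

  prev-< : ∀ {q} → q < t → prev q < t
  prev-< {zero}  _   = subst (pred t <_) (1+pred 2≤t) ℕₚ.≤-refl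
  prev-< {suc q} q<t = ℕₚ.<-trans (ℕₚ.n<1+n q) q<t

  next-prev : ∀ {q} → q < t → next (prev q) ≡ q
  next-prev {zero} _ with suc (pred t) ≡ᵇ t in eq
  ... | true  = refl
  ... | false = ⊥-elim (subst T eq (ℕₚ.≡⇒≡ᵇ _ _ (1+pred 2≤t)))
  next-prev {suc q} q<t with suc q ≡ᵇ t in eq
  ... | true  = ⊥-elim (ℕₚ.<-irrefl (ℕₚ.≡ᵇ⇒≡ _ _ (subst T (sym eq) _)) q<t)
  ... | false = refl

  next-injective : ∀ {k q} → next k ≡ q → k ≡ prev q
  next-injective {k} next-k≡q with suc k ≡ᵇ t in eq
  next-injective {k} refl | true  = cong pred (ℕₚ.≡ᵇ⇒≡ (suc k) t (subst T (sym eq) _))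
  next-injective {k} refl | false = refl

filled : Maybe ℤ → ℤ
filled (just _) = 1ℤ
filled nothing  = 0ℤ

occurrence : ℤ → Maybe ℤ → ℤ
occurrence x (just y) = if does (x ℤ.≟ y) then 1ℤ else 0ℤ
occurrence x nothing  = 0ℤ

occurrence-self : ∀ x → occurrence x (just x) ≡ 1ℤ
occurrence-self x rewrite dec-true (x ℤ.≟ x) refl = refl

occurrence-≢ : ∀ x y → x ≢ y → occurrence x (just y) ≡ 0ℤ
occurrence-≢ x y x≢y rewrite dec-false (x ℤ.≟ y) x≢y = refl

module ListMeasure (measure : List (Maybe ℤ) → ℤ) (μ : Maybe ℤ → ℤ)
                   (measure-[] : measure [] ≡ 0ℤ)
                   (measure-∷ : ∀ c cs → measure (c ∷ cs) ≡ μ c ⊕ measure cs) where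

  measure-++ : ∀ xs ys → measure (xs ++ ys) ≡ measure xs ⊕ measure ys
  measure-++ []       ys = sym (trans (cong (_⊕ measure ys) measure-[]) (ℤₚ.+-identityˡ (measure ys)))
  measure-++ (c ∷ xs) ys = begin
    measure (c ∷ xs ++ ys)           ≡⟨ measure-∷ c (xs ++ ys) ⟩
    μ c ⊕ measure (xs ++ ys)         ≡⟨ cong (μ c ⊕_) (measure-++ xs ys) ⟩
    μ c ⊕ (measure xs ⊕ measure ys)  ≡⟨ ℤₚ.+-assoc (μ c) (measure xs) (measure ys) ⟨
    (μ c ⊕ measure xs) ⊕ measure ys  ≡⟨ cong (_⊕ measure ys) (measure-∷ c xs) ⟨
    measure (c ∷ xs) ⊕ measure ys    ∎
    where open ≡-Reasoning

  measure-tabulate : ∀ n (G : ℕ → Maybe ℤ) → measure (tabulate {n = n} (G ∘ toℕ)) ≡ ∑[ j < n ] μ (G j)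
  measure-tabulate zero    G = measure-[]
  measure-tabulate (suc n) G = trans (measure-∷ _ _) (cong (μ (G 0) ⊕_) (measure-tabulate n (G ∘ suc)))

  measure-allFin : ∀ n (G : ℕ → Maybe ℤ) → measure (map (G ∘ toℕ) (allFin n)) ≡ ∑[ j < n ] μ (G j)
  measure-allFin n G = trans (cong measure (map-tabulate {n = n} (λ j → j) (G ∘ toℕ))) (measure-tabulate n G)

  measure-concat-tabulate : ∀ n (L : ℕ → List (Maybe ℤ)) →
                            measure (concat (tabulate {n = n} (L ∘ toℕ))) ≡ ∑[ i < n ] measure (L i)
  measure-concat-tabulate zero    L = measure-[]
  measure-concat-tabulate (suc n) L =
    trans (measure-++ (L 0) _) (cong (measure (L 0) ⊕_) (measure-concat-tabulate n (L ∘ suc)))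

  measure-concat-allFin : ∀ n (L : ℕ → List (Maybe ℤ)) →
                          measure (concat (map (L ∘ toℕ) (allFin n))) ≡ ∑[ i < n ] measure (L i)
  measure-concat-allFin n L =
    trans (cong (measure ∘ concat) (map-tabulate {n = n} (λ i → i) (L ∘ toℕ))) (measure-concat-tabulate n L)

filledCount-∷ : ∀ c cs → + filledCount (c ∷ cs) ≡ filled c ⊕ + filledCount cs
filledCount-∷ (just _) cs = refl
filledCount-∷ nothing  cs = refl

occurrences-∷ : ∀ x c cs → + occurrences x (c ∷ cs) ≡ occurrence x c ⊕ + occurrences x cs
occurrences-∷ x nothing  cs = refl
occurrences-∷ x (just y) cs with x ℤ.≟ y
... | yes _ = refl
... | no  _ = refl

-- The three statistics of an IsSMR record are read in ℤ, so that one summation ∑ serves all of them.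
module FilledCount = ListMeasure (λ cs → + filledCount cs) filled refl filledCount-∷
module CellSum = ListMeasure cellSum val refl (λ _ _ → refl)
module Occurrences (x : ℤ) = ListMeasure (λ cs → + occurrences x cs) (occurrence x) refl (occurrences-∷ x)

∑-occurrence-± : ∀ n x → InX n x →
                 ∑[ j < n ] (occurrence x (just (+ suc j)) ⊕ occurrence x (just (- (+ suc j)))) ≡ 1ℤ
∑-occurrence-± n (+ zero) (x≢0 , _) = ⊥-elim (x≢0 refl)
∑-occurrence-± n (+ suc u) (_ , u<n) =
  trans (∑-single n _ u<n off) (cong₂ _⊕_ (occurrence-self (+ suc u)) (occurrence-≢ (+ suc u) -[1+ u ] λ ()))
  where
  off : ∀ k → k < n → k ≢ u →
        occurrence (+ suc u) (just (+ suc k)) ⊕ occurrence (+ suc u) (just -[1+ k ]) ≡ 0ℤ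
  off k _ k≢u =
    cong₂ _⊕_ (occurrence-≢ (+ suc u) (+ suc k) (k≢u ∘ sym ∘ ℕₚ.suc-injective ∘ ℤₚ.+-injective))
              (occurrence-≢ (+ suc u) -[1+ k ] λ ())
∑-occurrence-± n -[1+ u ] (_ , u<n) =
  trans (∑-single n _ u<n off) (cong₂ _⊕_ (occurrence-≢ -[1+ u ] (+ suc u) λ ()) (occurrence-self -[1+ u ]))
  where
  off : ∀ k → k < n → k ≢ u →
        occurrence -[1+ u ] (just (+ suc k)) ⊕ occurrence -[1+ u ] (just -[1+ k ]) ≡ 0ℤ
  off k _ k≢u =
    cong₂ _⊕_ (occurrence-≢ -[1+ u ] (+ suc k) λ ())
              (occurrence-≢ -[1+ u ] -[1+ k ] (k≢u ∘ sym ∘ ℤₚ.-[1+-injective))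

ValidColumn : ℕ → ℕ × ℕ → Set
ValidColumn m p = proj₁ p < m × proj₂ p < m × proj₁ p ≢ proj₂ p

signed : ℕ × ℕ → ℕ → ℕ → Maybe ℤ
signed p v i = if i ≡ᵇ proj₁ p then just (+ v) else (if i ≡ᵇ proj₂ p then just (- (+ v)) else nothing)

signed-values : ∀ p v i {x} → signed p v i ≡ just x → x ≡ + v ⊎ x ≡ - (+ v)
signed-values p v i eq with i ≡ᵇ proj₁ p | i ≡ᵇ proj₂ p
... | true  | _     = inj₁ (sym (just-injective eq))
... | false | true  = inj₂ (sym (just-injective eq))

module TwoEntryColumns (m n : ℕ) (plan : ℕ → ℕ × ℕ)
                       (valid : ∀ j → j < n → ValidColumn m (plan j)) where

  entry : ℕ → ℕ → Maybe ℤ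
  entry i j = signed (plan j) (suc j) i

  array : PArray m n
  array i j = entry (toℕ i) (toℕ j)

  module Measure (μ : Maybe ℤ → ℤ) (μ-nothing : μ nothing ≡ 0ℤ) where

    μ⁺ μ⁻ : ℕ → ℤ
    μ⁺ j = μ (just (+ suc j))
    μ⁻ j = μ (just (- (+ suc j)))

    contribution : ℕ → ℕ × ℕ → ℕ → ℤ
    contribution r p j = (if r ≡ᵇ proj₁ p then μ⁺ j else 0ℤ)
                       ⊕ (if r ≡ᵇ proj₂ p then μ⁻ j else 0ℤ)

    measure-signed : ∀ p j r → proj₁ p ≢ proj₂ p → μ (signed p (suc j) r) ≡ contribution r p j
    measure-signed p j r distinct with r ≡ᵇ proj₁ p in eq₁ | r ≡ᵇ proj₂ p in eq₂
    ... | true  | true  = ⊥-elim (distinct (trans (sym (ℕₚ.≡ᵇ⇒≡ r _ (subst T (sym eq₁) _)))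
                                                   (ℕₚ.≡ᵇ⇒≡ r _ (subst T (sym eq₂) _))))
    ... | true  | false = sym (ℤₚ.+-identityʳ _)
    ... | false | true  = sym (ℤₚ.+-identityˡ _)
    ... | false | false = μ-nothing

    ∑-row : ∀ r → ∑[ j < n ] μ (entry r j) ≡ ∑[ j < n ] contribution r (plan j) j
    ∑-row r = ∑-cong n (λ j j<n → measure-signed (plan j) j r (proj₂ (proj₂ (valid j j<n))))

    ∑-column : ∀ j → j < n → ∑[ i < m ] μ (entry i j) ≡ μ⁺ j ⊕ μ⁻ j
    ∑-column j j<n = begin
      ∑[ i < m ] μ (entry i j)              ≡⟨ ∑-cong m (λ i _ → measure-signed (plan j) j i a≢b) ⟩
      ∑[ i < m ] contribution i (plan j) j  ≡⟨ ∑-⊕ m (at (μ⁺ j) a<m) (at (μ⁻ j) b<m) ⟩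
      μ⁺ j ⊕ μ⁻ j                           ∎
      where
      open ≡-Reasoning
      a<m = proj₁ (valid j j<n)
      b<m = proj₁ (proj₂ (valid j j<n))
      a≢b = proj₂ (proj₂ (valid j j<n))
      at : ∀ {a} (w : ℤ) → a < m → ∑[ i < m ] (if i ≡ᵇ a then w else 0ℤ) ≡ w
      at {a} w a<m =
        ∑-if-unique m (λ i → i ≡ᵇ a) (λ _ → w) a<m (ℕₚ.≡⇒≡ᵇ a a refl) (λ i _ → ℕₚ.≡ᵇ⇒≡ i a)

  entry-∈X : ∀ i j → j < n → ∀ {x} → entry i j ≡ just x → InX n x
  entry-∈X i j j<n eq with signed-values (plan j) (suc j) i eq
  ... | inj₁ refl = (λ ()) , j<n
  ... | inj₂ refl = (λ ()) , j<n

  occurrences-cells : ∀ x → InX n x → + occurrences x (cells array) ≡ 1ℤ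
  occurrences-cells x x∈X = begin
    + occurrences x (cells array)
      ≡⟨ Occurrences.measure-concat-allFin x m (λ i → map (entry i ∘ toℕ) (allFin n)) ⟩
    ∑[ i < m ] (+ occurrences x (map (entry i ∘ toℕ) (allFin n)))
      ≡⟨ ∑-cong m (λ i _ → Occurrences.measure-allFin x n (entry i)) ⟩
    ∑[ i < m ] (∑[ j < n ] occurrence x (entry i j))
      ≡⟨ ∑-comm m n (λ i j → occurrence x (entry i j)) ⟩
    ∑[ j < n ] (∑[ i < m ] occurrence x (entry i j))
      ≡⟨ ∑-cong n (Measure.∑-column (occurrence x) refl) ⟩
    ∑[ j < n ] (occurrence x (just (+ suc j)) ⊕ occurrence x (just (- (+ suc j))))
      ≡⟨ ∑-occurrence-± n x x∈X ⟩
    1ℤ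
      ∎
    where open ≡-Reasoning

  isSMR : ∀ r → 2 * n ≡ m * r →
          (∀ i → i < m → ∑[ j < n ] filled (entry i j) ≡ + r) →
          (∀ i → i < m → ∑[ j < n ] val (entry i j) ≡ 0ℤ) →
          IsSMR m n r 2 n array
  isSMR r 2n≡mr rows-filled rows-sum = record
    { half       = 2n≡mr
    ; rowFilled  = λ i → ℤₚ.+-injective (trans (FilledCount.measure-allFin n (entry (toℕ i)))
                                               (rows-filled (toℕ i) (toℕ<n i)))
    ; colFilled  = λ j → ℤₚ.+-injective (trans (FilledCount.measure-allFin m (λ i → entry i (toℕ j)))
                                               (Measure.∑-column filled refl (toℕ j) (toℕ<n j)))
    ; entriesInX = λ i j x → entry-∈X (toℕ i) (toℕ j) (toℕ<n j)
    ; eachOnce   = λ x x∈X → ℤₚ.+-injective (occurrences-cells x x∈X)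
    ; rowSum     = λ i → trans (CellSum.measure-allFin n (entry (toℕ i))) (rows-sum (toℕ i) (toℕ<n i))
    ; colSum     = λ j → trans (CellSum.measure-allFin m (λ i → entry i (toℕ j)))
                               (trans (Measure.∑-column val refl (toℕ j) (toℕ<n j))
                                      (ℤₚ.+-inverseʳ (+ suc (toℕ j))))
    }

module Construction (t : ℕ) (2≤t : 2 ≤ t) where
  open Cyclic t 2≤t

  block₀ block₁ block₂ block₃ block₄ : ℕ → ℕ × ℕ
  block₀ k = k * 2 , next k * 2
  block₁ k = k * 2 , suc (k * 2)
  block₂ k = next k * 2 , suc (k * 2)
  block₃ k = suc (k * 2) , suc (next k * 2)
  block₄ k = suc (next k * 2) , k * 2

  blocks₃₋₄ blocks₂₋₄ blocks₁₋₄ plan : ℕ → ℕ × ℕ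
  blocks₃₋₄ = interleave block₃ block₄
  blocks₂₋₄ = splice t block₂ blocks₃₋₄
  blocks₁₋₄ = splice t block₁ blocks₂₋₄
  plan      = splice t block₀ blocks₁₋₄

  5t≡t+t+t+2t : 5 * t ≡ t + (t + (t + t * 2))
  5t≡t+t+t+2t = identity t
    where
    identity : ∀ t → 5 * t ≡ t + (t + (t + t * 2))
    identity = ℕ-Solver.solve-∀

  plan-valid : ∀ j → j < 5 * t → ValidColumn (t * 2) (plan j)
  plan-valid j j<5t =
    splice-all V t _ (λ k k<t → *2-< k<t , *2-< (next-< k<t) , next-≢ ∘ sym ∘ *2-injective)
   (splice-all V t _ (λ k k<t → *2-< k<t , 1+*2-< k<t , m*2≢1+n*2 k k)
   (splice-all V t _ (λ k k<t → *2-< (next-< k<t) , 1+*2-< k<t , m*2≢1+n*2 (next k) k)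
   (interleave-all V t (λ k k<t → 1+*2-< k<t , 1+*2-< (next-< k<t) ,
                                  next-≢ ∘ sym ∘ *2-injective ∘ ℕₚ.suc-injective)
                       (λ k k<t → 1+*2-< (next-< k<t) , *2-< k<t , m*2≢1+n*2 k (next k) ∘ sym))))
    j (subst (j <_) 5t≡t+t+t+2t j<5t)
    where V = ValidColumn (t * 2)

  open TwoEntryColumns (t * 2) (5 * t) plan plan-valid public

  module _ (w : ℕ → ℤ) {q : ℕ} (q<t : q < t) where

    ∑-at-even : ∑[ k < t ] (if q * 2 ≡ᵇ k * 2 then w k else 0ℤ) ≡ w q
    ∑-at-even = ∑-match-unique t (q * 2) (_* 2) w q<t refl (λ k _ → sym ∘ *2-injective)

    ∑-at-even-next : ∑[ k < t ] (if q * 2 ≡ᵇ next k * 2 then w k else 0ℤ) ≡ w (prev q)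
    ∑-at-even-next = ∑-match-unique t (q * 2) (λ k → next k * 2) w (prev-< q<t)
                       (cong (_* 2) (sym (next-prev q<t)))
                       (λ k _ e → next-injective (sym (*2-injective {q} {next k} e)))

    ∑-at-odd : ∑[ k < t ] (if suc (q * 2) ≡ᵇ suc (k * 2) then w k else 0ℤ) ≡ w q
    ∑-at-odd = ∑-match-unique t (suc (q * 2)) (λ k → suc (k * 2)) w q<t refl
                 (λ k _ → sym ∘ *2-injective ∘ ℕₚ.suc-injective)

    ∑-at-odd-next : ∑[ k < t ] (if suc (q * 2) ≡ᵇ suc (next k * 2) then w k else 0ℤ) ≡ w (prev q)
    ∑-at-odd-next = ∑-match-unique t (suc (q * 2)) (λ k → suc (next k * 2)) w (prev-< q<t)
                      (cong (λ k → suc (k * 2)) (sym (next-prev q<t)))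
                      (λ k _ e → next-injective (sym (*2-injective {q} {next k} (ℕₚ.suc-injective e))))

  ∑-even-misses-odd : ∀ (w : ℕ → ℤ) q (ρ : ℕ → ℕ) →
                      ∑[ k < t ] (if q * 2 ≡ᵇ suc (ρ k * 2) then w k else 0ℤ) ≡ 0ℤ
  ∑-even-misses-odd w q ρ = ∑-match-none t _ _ w (λ k _ → m*2≢1+n*2 q (ρ k))

  ∑-odd-misses-even : ∀ (w : ℕ → ℤ) q (ρ : ℕ → ℕ) →
                      ∑[ k < t ] (if suc (q * 2) ≡ᵇ ρ k * 2 then w k else 0ℤ) ≡ 0ℤ
  ∑-odd-misses-even w q ρ = ∑-match-none t _ _ w (λ k _ → m*2≢1+n*2 (ρ k) q ∘ sym)

  module Rows (μ : Maybe ℤ → ℤ) (μ-nothing : μ nothing ≡ 0ℤ) where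
    open Measure μ μ-nothing

    ∑-blocks : ∀ r → ∑[ j < 5 * t ] contribution r (plan j) j ≡
      ∑[ k < t ] contribution r (block₀ k) k ⊕
      (∑[ k < t ] contribution r (block₁ k) (t + k) ⊕
      (∑[ k < t ] contribution r (block₂ k) (t + (t + k)) ⊕
       ∑[ k < t ] (contribution r (block₃ k) (t + (t + (t + k * 2))) ⊕
                   contribution r (block₄ k) (t + (t + (t + suc (k * 2)))))))
    ∑-blocks r = begin
      ∑[ j < 5 * t ] c (plan j) j
        ≡⟨ cong (λ n → ∑[ j < n ] c (plan j) j) 5t≡t+t+t+2t ⟩
      ∑[ j < t + (t + (t + t * 2)) ] c (plan j) j
        ≡⟨ ∑-splice t _ block₀ blocks₁₋₄ c ⟩
      B₀ ⊕ ∑[ k < t + (t + t * 2) ] c (blocks₁₋₄ k) (t + k)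
        ≡⟨ cong (B₀ ⊕_) (∑-splice t _ block₁ blocks₂₋₄ (λ x k → c x (t + k))) ⟩
      B₀ ⊕ (B₁ ⊕ ∑[ k < t + t * 2 ] c (blocks₂₋₄ k) (t + (t + k)))
        ≡⟨ cong (λ x → B₀ ⊕ (B₁ ⊕ x))
                (∑-splice t _ block₂ blocks₃₋₄ (λ x k → c x (t + (t + k)))) ⟩
      B₀ ⊕ (B₁ ⊕ (B₂ ⊕ ∑[ k < t * 2 ] c (blocks₃₋₄ k) (t + (t + (t + k)))))
        ≡⟨ cong (λ x → B₀ ⊕ (B₁ ⊕ (B₂ ⊕ x)))
                (∑-interleave t block₃ block₄ (λ x k → c x (t + (t + (t + k))))) ⟩
      B₀ ⊕ (B₁ ⊕ (B₂ ⊕ B₃₄))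
        ∎
      where
      open ≡-Reasoning
      c = contribution r
      B₀ = ∑[ k < t ] c (block₀ k) k
      B₁ = ∑[ k < t ] c (block₁ k) (t + k)
      B₂ = ∑[ k < t ] c (block₂ k) (t + (t + k))
      B₃₄ = ∑[ k < t ] (c (block₃ k) (t + (t + (t + k * 2)))
                      ⊕ c (block₄ k) (t + (t + (t + suc (k * 2)))))

    row-even : ∀ q → q < t → ∑[ j < 5 * t ] contribution (q * 2) (plan j) j ≡
               μ⁺ q ⊕ μ⁻ (prev q) ⊕ μ⁺ (t + q) ⊕ μ⁺ (t + (t + prev q)) ⊕
               μ⁻ (t + (t + (t + suc (q * 2))))
    row-even q q<t = trans (∑-blocks (q * 2)) (trans
      (cong₂ _⊕_ (∑-⊕ t (∑-at-even _ q<t) (∑-at-even-next _ q<t))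
      (cong₂ _⊕_ (∑-⊕ t (∑-at-even _ q<t) (∑-even-misses-odd _ q (λ k → k)))
      (cong₂ _⊕_ (∑-⊕ t (∑-at-even-next _ q<t) (∑-even-misses-odd _ q (λ k → k)))
                 (∑-⊕ t (∑-⊕ t (∑-even-misses-odd _ q (λ k → k)) (∑-even-misses-odd _ q next))
                        (∑-⊕ t (∑-even-misses-odd _ q next) (∑-at-even _ q<t))))))
      (drop-zeros (μ⁺ q) (μ⁻ (prev q)) (μ⁺ (t + q)) (μ⁺ (t + (t + prev q)))
                  (μ⁻ (t + (t + (t + suc (q * 2)))))))
      where
      drop-zeros : ∀ a b c d e →
                   (a ⊕ b) ⊕ ((c ⊕ 0ℤ) ⊕ ((d ⊕ 0ℤ) ⊕ ((0ℤ ⊕ 0ℤ) ⊕ (0ℤ ⊕ e)))) ≡ a ⊕ b ⊕ c ⊕ d ⊕ e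
      drop-zeros = ℤ-Solver.solve-∀

    row-odd : ∀ q → q < t → ∑[ j < 5 * t ] contribution (suc (q * 2)) (plan j) j ≡
              μ⁻ (t + q) ⊕ μ⁻ (t + (t + q)) ⊕ μ⁺ (t + (t + (t + q * 2))) ⊕
              μ⁻ (t + (t + (t + prev q * 2))) ⊕ μ⁺ (t + (t + (t + suc (prev q * 2))))
    row-odd q q<t = trans (∑-blocks (suc (q * 2))) (trans
      (cong₂ _⊕_ (∑-⊕ t (∑-odd-misses-even _ q (λ k → k)) (∑-odd-misses-even _ q next))
      (cong₂ _⊕_ (∑-⊕ t (∑-odd-misses-even _ q (λ k → k)) (∑-at-odd _ q<t))
      (cong₂ _⊕_ (∑-⊕ t (∑-odd-misses-even _ q next) (∑-at-odd _ q<t))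
                 (∑-⊕ t (∑-⊕ t (∑-at-odd _ q<t) (∑-at-odd-next _ q<t))
                        (∑-⊕ t (∑-at-odd-next _ q<t) (∑-odd-misses-even _ q (λ k → k)))))))
      (drop-zeros (μ⁻ (t + q)) (μ⁻ (t + (t + q))) (μ⁺ (t + (t + (t + q * 2))))
                  (μ⁻ (t + (t + (t + prev q * 2)))) (μ⁺ (t + (t + (t + suc (prev q * 2)))))))
      where
      drop-zeros : ∀ a b c d e →
                   (0ℤ ⊕ 0ℤ) ⊕ ((0ℤ ⊕ a) ⊕ ((0ℤ ⊕ b) ⊕ ((c ⊕ d) ⊕ (e ⊕ 0ℤ)))) ≡ a ⊕ b ⊕ c ⊕ d ⊕ e
      drop-zeros = ℤ-Solver.solve-∀

  even-row-vanishes : ∀ q → + suc q ⊕ - (+ suc (prev q)) ⊕ + suc (t + q) ⊕ + suc (t + (t + prev q)) ⊕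
                            - (+ suc (t + (t + (t + suc (q * 2))))) ≡ 0ℤ
  even-row-vanishes q rewrite m*2≡m+m q = identity (+ t) (+ q) (+ prev q)
    where
    identity : ∀ T Q P → (1ℤ ⊕ Q) ⊕ - (1ℤ ⊕ P) ⊕ (1ℤ ⊕ (T ⊕ Q)) ⊕ (1ℤ ⊕ (T ⊕ (T ⊕ P))) ⊕
                         - (1ℤ ⊕ (T ⊕ (T ⊕ (T ⊕ (1ℤ ⊕ (Q ⊕ Q)))))) ≡ 0ℤ
    identity = ℤ-Solver.solve-∀

  odd-row-vanishes : ∀ q → - (+ suc (t + q)) ⊕ - (+ suc (t + (t + q))) ⊕ + suc (t + (t + (t + q * 2))) ⊕
                           - (+ suc (t + (t + (t + prev q * 2)))) ⊕ + suc (t + (t + (t + suc (prev q * 2)))) ≡ 0ℤ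
  odd-row-vanishes q rewrite m*2≡m+m q | m*2≡m+m (prev q) = identity (+ t) (+ q) (+ prev q)
    where
    identity : ∀ T Q P → - (1ℤ ⊕ (T ⊕ Q)) ⊕ - (1ℤ ⊕ (T ⊕ (T ⊕ Q))) ⊕
                         (1ℤ ⊕ (T ⊕ (T ⊕ (T ⊕ (Q ⊕ Q))))) ⊕ - (1ℤ ⊕ (T ⊕ (T ⊕ (T ⊕ (P ⊕ P))))) ⊕
                         (1ℤ ⊕ (T ⊕ (T ⊕ (T ⊕ (1ℤ ⊕ (P ⊕ P)))))) ≡ 0ℤ
    identity = ℤ-Solver.solve-∀

  rows-filled : ∀ i → i < t * 2 → ∑[ j < 5 * t ] filled (entry i j) ≡ + 5
  rows-filled i i<2t with evenOdd i
  ... | even q = trans (Measure.∑-row filled refl (q * 2)) (Rows.row-even filled refl q (*2-<⁻¹ i<2t))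
  ... | odd  q = trans (Measure.∑-row filled refl (suc (q * 2))) (Rows.row-odd filled refl q (1+*2-<⁻¹ i<2t))

  rows-sum : ∀ i → i < t * 2 → ∑[ j < 5 * t ] val (entry i j) ≡ 0ℤ
  rows-sum i i<2t with evenOdd i
  ... | even q = trans (Measure.∑-row val refl (q * 2))
                       (trans (Rows.row-even val refl q (*2-<⁻¹ i<2t)) (even-row-vanishes q))
  ... | odd  q = trans (Measure.∑-row val refl (suc (q * 2)))
                       (trans (Rows.row-odd val refl q (1+*2-<⁻¹ i<2t)) (odd-row-vanishes q))

  array-isSMR : IsSMR (t * 2) (5 * t) 5 2 (5 * t) array
  array-isSMR = isSMR 5 (identity t) rows-filled rows-sum
    where
    identity : ∀ t → 2 * (5 * t) ≡ t * 2 * 5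
    identity = ℕ-Solver.solve-∀

5*[t*2]/2≡5*t : ∀ t → (5 * (t * 2)) / 2 ≡ 5 * t
5*[t*2]/2≡5*t t = trans (cong (_/ 2) (sym (ℕₚ.*-assoc 5 t 2))) (m*n/n≡m (5 * t) 2)

proposition9 : (m : ℕ) → 2 ∣ m → 4 ≤ m →
    ∃ λ (A : PArray m ((5 * m) / 2)) → IsSMR m ((5 * m) / 2) 5 2 ((5 * m) / 2) A
proposition9 .(t * 2) (divides t refl) 4≤m rewrite 5*[t*2]/2≡5*t t =
  Construction.array t 2≤t , Construction.array-isSMR t 2≤t
  where
  2≤t : 2 ≤ t
  2≤t = ℕₚ.*-cancelʳ-≤ 2 t 2 4≤m
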